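{- For every $n\geq 0$ and every $P\in\mathcal{D}_n^{h,\geq}$, $$\#UUU(P)=\#UF^+D(\phi(P))+2\big(\#UF^+U(\phi(P))+\#UU(\phi(P))\big).$$
   Context: A Motzkin path of length $n$ is a word in the steps $U=(1,1)$, $D=(1,-1)$, $F=(1,0)$ forming a lattice path from $(0,0)$ to $(n,0)$ never going below the $x$-axis; $\mathcal{M}_n$ is the set of them. A Dyck path of semilength $n$ is a Motzkin path of length $2n$ without $F$ steps. Every nonempty Dyck path has a unique first return decomposition $P=U\alpha D\beta$ with $\alpha,\beta$ Dyck paths; $h$ denotes maximal height. $\mathcal{D}^{h,\geq}$ is defined recursively: it contains the empty path $\epsilon$, and $P=U\alpha D\beta$ belongs to it iff $\alpha,\beta\in\mathcal{D}^{h,\geq}$ and $h(U\alpha D)\geq h(\beta)$; $\mathcal{D}_n^{h,\geq}$ is the subset of semilength $n$. The bijection $\phi:\mathcal{D}_n^{h,\geq}\to\mathcal{M}_n$ is defined by $\phi(\epsilon)=\epsilon$, $\phi(\alpha UD)=\phi(\alpha)F$, $\phi(\alpha UU\beta D\gamma D)=\phi(\alpha)\phi(\gamma)U\phi(\beta)D$. For a word $X$, $\#X(P)$ is the number of occurrences of $X$ as consecutive steps in $P$. For words $Y,Z$ and a step $S$, $\#YS^+Z(P)=\sum_{k\geq 1}\#YS^kZ(P)$, where $S^k$ is $k$ consecutive copies of $S$. -}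

module Defs where

open import Data.Nat using (ℕ; zero; suc; _+_; _⊔_; _≥_)
open import Data.Bool using (Bool; true; false; _∧_; if_then_else_)
open import Data.List using (List; []; _∷_; _++_; [_]; replicate; length)
open import Data.Maybe using (Maybe; just; nothing)
open import Data.Product using (_×_; _,_)

-- Steps U = (1,1), D = (1,-1), F = (1,0); paths are words (lists of steps).
data Step : Set where
  U D F : Step

Word : Set
Word = List Step

_=ˢ_ : Step → Step → Bool
U =ˢ U = true
D =ˢ D = true
F =ˢ F = true
_ =ˢ _ = false

isPrefix : Word → Word → Bool
isPrefix [] _ = true
isPrefix (_ ∷ _) [] = false
isPrefix (x ∷ xs) (y ∷ ys) = (x =ˢ y) ∧ isPrefix xs ys

-- #X(P): number of occurrences of X as consecutive steps (a factor) of P,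
-- i.e. number of positions i with X a prefix of the suffix of P starting at i.
-- (For X = [] we count positions 0..length P - 1; only nonempty X are used.)
count : Word → Word → ℕ
count X [] = 0
count X (y ∷ ys) = (if isPrefix X (y ∷ ys) then 1 else 0) + count X ys

-- #Y S^+ Z (P) = Σ_{k ≥ 1} #Y S^k Z (P). Terms with k > length P vanish,
-- so the sum is truncated at k = length P.
countPlusUpTo : ℕ → Word → Step → Word → Word → ℕ
countPlusUpTo zero Y S Z P = 0
countPlusUpTo (suc k) Y S Z P =
  count (Y ++ replicate (suc k) S ++ Z) P + countPlusUpTo k Y S Z P

countPlus : Word → Step → Word → Word → ℕ
countPlus Y S Z P = countPlusUpTo (length P) Y S Z P

-- Dyck paths, represented via their (unique) first return decomposition:
-- ε is the empty path, and  fr α β  is the path  U α D β.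
data Dyck : Set where
  ε  : Dyck
  fr : Dyck → Dyck → Dyck

word : Dyck → Word
word ε = []
word (fr α β) = U ∷ word α ++ D ∷ word β

semilength : Dyck → ℕ
semilength ε = 0
semilength (fr α β) = suc (semilength α + semilength β)

h : Dyck → ℕ
h ε = 0
h (fr α β) = suc (h α) ⊔ h β

data InDh≥ : Dyck → Set where
  ε-in  : InDh≥ ε
  fr-in : ∀ {α β} → InDh≥ α → InDh≥ β → h (fr α ε) ≥ h β → InDh≥ (fr α β)

-- last return decomposition: a nonempty P is written P = α U σ D
lastDec : Dyck → Maybe (Dyck × Dyck)
lastDec ε = nothing
lastDec (fr a b) with lastDec b
... | nothing = just (ε , a)
... | just (α , σ) = just (fr a α , σ)

-- φ with fuel: φ(ε) = ε, φ(α U D) = φ(α) F,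
-- φ(α U U β D γ D) = φ(α) φ(γ) U φ(β) D   (here σ = U β D γ).
φ-fuel : ℕ → Dyck → Word
φ-fuel zero _ = []
φ-fuel (suc k) P with lastDec P
... | nothing = []
... | just (α , ε) = φ-fuel k α ++ [ F ]
... | just (α , fr β γ) = φ-fuel k α ++ φ-fuel k γ ++ U ∷ φ-fuel k β ++ [ D ]

-- semilength P is sufficient fuel (every recursive call is on a path of
-- strictly smaller semilength).
φ : Dyck → Word
φ P = φ-fuel (semilength P) P

-- Give the U step of a Motzkin path that is followed by the suffix v the weight
-- 2 if v ∈ F*U…, 1 if v ∈ F⁺D…, 0 if v ∈ D…; the sum of these weights is exactly
-- #UF⁺D + 2(#UF⁺U + #UU). Since every U is followed by a later non-F step, the
-- weight of φ(α U U β D γ D) = φ(α) φ(γ) U φ(β) D is additive, and the new U gets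
-- weight min(2, h β): φ(β) is empty, a nonempty run of F's, or begins with F*U
-- according as h β = 0, 1 or ≥ 2. On the Dyck side the same factor U U β D γ D
-- adds min(2, h β) occurrences of UUU at its start: one if β ≠ ε, and one more if
-- β begins with UU, which for β ∈ D^{h,≥} happens exactly when h β ≥ 2.

module Submission where

open import Defs
open import Data.Nat using (ℕ; zero; suc; _+_; _*_; _≤_; _<_; _⊔_; _⊓_; z≤n; s≤s)
open import Data.Nat.Properties
open import Data.Nat.Tactic.RingSolver using (solve-∀)
open import Data.List using ([]; _∷_; _++_; replicate; length)
open import Data.List.Properties using (++-conicalʳ)
open import Data.Bool using (Bool; false; _∧_; if_then_else_)
open import Data.Maybe using (Maybe; just; nothing; _<∣>_; maybe′; Is-just)
open import Data.Maybe.Relation.Unary.Any using (just)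
open import Data.Product using (_×_; _,_; proj₁; proj₂)
open import Data.Sum as Sum using (_⊎_; inj₁; inj₂)
open import Data.Unit using (⊤; tt)
open import Data.Empty using (⊥-elim)
open import Relation.Nullary using (contradiction)
open import Relation.Binary.PropositionalEquality
open import Algebra.Properties.CommutativeSemigroup +-commutativeSemigroup
  using (interchange; x∙yz≈y∙xz)
open ≡-Reasoning

⟦_⟧ : Bool → ℕ
⟦ b ⟧ = if b then 1 else 0

sumAfterU : (Word → ℕ) → Word → ℕ
sumAfterU f []      = 0
sumAfterU f (U ∷ w) = f w + sumAfterU f w
sumAfterU f (D ∷ w) = sumAfterU f w
sumAfterU f (F ∷ w) = sumAfterU f w

sumAfterU-+ : ∀ f g w → sumAfterU (λ v → f v + g v) w ≡ sumAfterU f w + sumAfterU g w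
sumAfterU-+ f g []      = refl
sumAfterU-+ f g (U ∷ w) = trans (cong (f w + g w +_) (sumAfterU-+ f g w))
                                (interchange (f w) (g w) (sumAfterU f w) (sumAfterU g w))
sumAfterU-+ f g (D ∷ w) = sumAfterU-+ f g w
sumAfterU-+ f g (F ∷ w) = sumAfterU-+ f g w

sumAfterU-* : ∀ c f w → sumAfterU (λ v → c * f v) w ≡ c * sumAfterU f w
sumAfterU-* c f []      = sym (*-zeroʳ c)
sumAfterU-* c f (U ∷ w) = trans (cong (c * f w +_) (sumAfterU-* c f w))
                                (sym (*-distribˡ-+ c (f w) (sumAfterU f w)))
sumAfterU-* c f (D ∷ w) = sumAfterU-* c f w
sumAfterU-* c f (F ∷ w) = sumAfterU-* c f w

sumAfterU-cong : ∀ {f g} w → (∀ v → length v < length w → f v ≡ g v) →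
                 sumAfterU f w ≡ sumAfterU g w
sumAfterU-cong []      eq = refl
sumAfterU-cong (U ∷ w) eq = cong₂ _+_ (eq w ≤-refl) (sumAfterU-cong w (λ v lt → eq v (m<n⇒m<1+n lt)))
sumAfterU-cong (D ∷ w) eq = sumAfterU-cong w (λ v lt → eq v (m<n⇒m<1+n lt))
sumAfterU-cong (F ∷ w) eq = sumAfterU-cong w (λ v lt → eq v (m<n⇒m<1+n lt))

count-U∷ : ∀ X w → count (U ∷ X) w ≡ sumAfterU (λ v → ⟦ isPrefix X v ⟧) w
count-U∷ X []      = refl
count-U∷ X (U ∷ w) = cong (⟦ isPrefix X w ⟧ +_) (count-U∷ X w)
count-U∷ X (D ∷ w) = count-U∷ X w
count-U∷ X (F ∷ w) = count-U∷ X w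

prefixPlusUpTo : ℕ → Word → Step → Word → Word → ℕ
prefixPlusUpTo zero    Y S Z v = 0
prefixPlusUpTo (suc k) Y S Z v =
  ⟦ isPrefix (Y ++ replicate (suc k) S ++ Z) v ⟧ + prefixPlusUpTo k Y S Z v

sumAfterU-0 : ∀ w → sumAfterU (λ _ → 0) w ≡ 0
sumAfterU-0 []      = refl
sumAfterU-0 (U ∷ w) = sumAfterU-0 w
sumAfterU-0 (D ∷ w) = sumAfterU-0 w
sumAfterU-0 (F ∷ w) = sumAfterU-0 w

countPlusUpTo-U∷ : ∀ n Y S Z w →
  countPlusUpTo n (U ∷ Y) S Z w ≡ sumAfterU (prefixPlusUpTo n Y S Z) w
countPlusUpTo-U∷ zero    Y S Z w = sym (sumAfterU-0 w)
countPlusUpTo-U∷ (suc n) Y S Z w =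
  trans (cong₂ _+_ (count-U∷ (Y ++ replicate (suc n) S ++ Z) w) (countPlusUpTo-U∷ n Y S Z w))
        (sym (sumAfterU-+ _ (prefixPlusUpTo n Y S Z) w))

prefixPlusUpTo-[] : ∀ n S Z → prefixPlusUpTo n [] S Z [] ≡ 0
prefixPlusUpTo-[] zero    S Z = refl
prefixPlusUpTo-[] (suc n) S Z = prefixPlusUpTo-[] n S Z

prefixPlusUpTo-≢F : ∀ n Z x v → F =ˢ x ≡ false → prefixPlusUpTo n [] F Z (x ∷ v) ≡ 0
prefixPlusUpTo-≢F zero    Z x v x≢F = refl
prefixPlusUpTo-≢F (suc n) Z x v x≢F rewrite x≢F = prefixPlusUpTo-≢F n Z x v x≢F

prefixPlusUpTo-F∷ : ∀ n Z v →
  prefixPlusUpTo (suc n) [] F Z (F ∷ v) ≡ ⟦ isPrefix Z v ⟧ + prefixPlusUpTo n [] F Z v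
prefixPlusUpTo-F∷ zero    Z v = refl
prefixPlusUpTo-F∷ (suc n) Z v =
  trans (cong (⟦ isPrefix (replicate (suc n) F ++ Z) v ⟧ +_) (prefixPlusUpTo-F∷ n Z v))
        (x∙yz≈y∙xz ⟦ isPrefix (replicate (suc n) F ++ Z) v ⟧ ⟦ isPrefix Z v ⟧ (prefixPlusUpTo n [] F Z v))

firstNonF : Word → Maybe Step
firstNonF []      = nothing
firstNonF (F ∷ w) = firstNonF w
firstNonF (x ∷ w) = just x

F*Then : Step → Word → ℕ
F*Then z v = maybe′ (λ x → ⟦ x =ˢ z ⟧) 0 (firstNonF v)

F⁺Then : Step → Word → ℕ
F⁺Then z (F ∷ v) = F*Then z v
F⁺Then z _       = 0

prefixPlusUpTo-F* : ∀ z → z =ˢ F ≡ false → ∀ n v → length v ≤ n →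
  ⟦ isPrefix (z ∷ []) v ⟧ + prefixPlusUpTo n [] F (z ∷ []) v ≡ F*Then z v
prefixPlusUpTo-F* z _   n       []      _        = prefixPlusUpTo-[] n F (z ∷ [])
prefixPlusUpTo-F* U _   n       (U ∷ v) _        = cong suc (prefixPlusUpTo-≢F n _ U v refl)
prefixPlusUpTo-F* U _   n       (D ∷ v) _        = prefixPlusUpTo-≢F n _ D v refl
prefixPlusUpTo-F* D _   n       (U ∷ v) _        = prefixPlusUpTo-≢F n _ U v refl
prefixPlusUpTo-F* D _   n       (D ∷ v) _        = cong suc (prefixPlusUpTo-≢F n _ D v refl)
prefixPlusUpTo-F* z z≢F (suc n) (F ∷ v) (s≤s le) rewrite z≢F =
  trans (prefixPlusUpTo-F∷ n (z ∷ []) v) (prefixPlusUpTo-F* z z≢F n v le)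

prefixPlusUpTo-F⁺ : ∀ z → z =ˢ F ≡ false → ∀ n v → length v ≤ n →
  prefixPlusUpTo n [] F (z ∷ []) v ≡ F⁺Then z v
prefixPlusUpTo-F⁺ z _   n       []      _        = prefixPlusUpTo-[] n F (z ∷ [])
prefixPlusUpTo-F⁺ z _   n       (U ∷ v) _        = prefixPlusUpTo-≢F n _ U v refl
prefixPlusUpTo-F⁺ z _   n       (D ∷ v) _        = prefixPlusUpTo-≢F n _ D v refl
prefixPlusUpTo-F⁺ z z≢F (suc n) (F ∷ v) (s≤s le) =
  trans (prefixPlusUpTo-F∷ n (z ∷ []) v) (prefixPlusUpTo-F* z z≢F n v le)

-- countPlus truncates at k = length w, beyond the length of any run of F's in w.
countPlus-UF⁺ : ∀ z → z =ˢ F ≡ false → ∀ w →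
  countPlus (U ∷ []) F (z ∷ []) w ≡ sumAfterU (F⁺Then z) w
countPlus-UF⁺ z z≢F w =
  trans (countPlusUpTo-U∷ (length w) [] F (z ∷ []) w)
        (sumAfterU-cong w (λ v lt → prefixPlusUpTo-F⁺ z z≢F (length w) v (<⇒≤ lt)))

weightAfterF : Maybe Step → ℕ
weightAfterF (just U) = 2
weightAfterF (just D) = 1
weightAfterF _        = 0

uWeight : Word → ℕ
uWeight (U ∷ _) = 2
uWeight (F ∷ v) = weightAfterF (firstNonF v)
uWeight _       = 0

weight : Word → ℕ
weight = sumAfterU uWeight

uWeight-decomposition : ∀ v →
  uWeight v ≡ F⁺Then D v + 2 * (F⁺Then U v + ⟦ isPrefix (U ∷ []) v ⟧)
uWeight-decomposition []      = refl
uWeight-decomposition (U ∷ v) = refl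
uWeight-decomposition (D ∷ v) = refl
uWeight-decomposition (F ∷ v) with firstNonF v
... | nothing = refl
... | just U  = refl
... | just D  = refl
... | just F  = refl

weight-decomposition : ∀ w →
  weight w ≡ countPlus (U ∷ []) F (D ∷ []) w
             + 2 * (countPlus (U ∷ []) F (U ∷ []) w + count (U ∷ U ∷ []) w)
weight-decomposition w = begin
  sumAfterU uWeight w
    ≡⟨ sumAfterU-cong w (λ v _ → uWeight-decomposition v) ⟩
  sumAfterU (λ v → F⁺Then D v + 2 * (F⁺Then U v + startsU v)) w
    ≡⟨ sumAfterU-+ (F⁺Then D) _ w ⟩
  sumAfterU (F⁺Then D) w + sumAfterU (λ v → 2 * (F⁺Then U v + startsU v)) w
    ≡⟨ cong (sumAfterU (F⁺Then D) w +_)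
            (trans (sumAfterU-* 2 _ w) (cong (2 *_) (sumAfterU-+ (F⁺Then U) startsU w))) ⟩
  sumAfterU (F⁺Then D) w + 2 * (sumAfterU (F⁺Then U) w + sumAfterU startsU w)
    ≡⟨ cong₂ (λ x y → x + 2 * y) (countPlus-UF⁺ D refl w)
             (cong₂ _+_ (countPlus-UF⁺ U refl w) (count-U∷ (U ∷ []) w)) ⟨
  countPlus (U ∷ []) F (D ∷ []) w
    + 2 * (countPlus (U ∷ []) F (U ∷ []) w + count (U ∷ U ∷ []) w) ∎
  where
  startsU : Word → ℕ
  startsU v = ⟦ isPrefix (U ∷ []) v ⟧

firstNonF-++ : ∀ a b → firstNonF (a ++ b) ≡ firstNonF a <∣> firstNonF b
firstNonF-++ []      b = refl
firstNonF-++ (U ∷ a) b = refl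
firstNonF-++ (D ∷ a) b = refl
firstNonF-++ (F ∷ a) b = firstNonF-++ a b

firstNonF-++-D∷ : ∀ a b → Is-just (firstNonF (a ++ D ∷ b))
firstNonF-++-D∷ []      b = just tt
firstNonF-++-D∷ (U ∷ a) b = just tt
firstNonF-++-D∷ (D ∷ a) b = just tt
firstNonF-++-D∷ (F ∷ a) b = firstNonF-++-D∷ a b

firstNonF-++-U : ∀ a b → firstNonF a ≡ nothing ⊎ firstNonF a ≡ just U →
                 firstNonF b ≡ just U → firstNonF (a ++ b) ≡ just U
firstNonF-++-U a b (inj₁ e) eb = trans (firstNonF-++ a b) (trans (cong (_<∣> _) e) eb)
firstNonF-++-U a b (inj₂ e) eb = trans (firstNonF-++ a b) (cong (_<∣> _) e)

<∣>-Is-just : ∀ {A : Set} {m : Maybe A} m′ → Is-just m → m <∣> m′ ≡ m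
<∣>-Is-just m′ (just _) = refl

NonFAfterEachU : Word → Set
NonFAfterEachU []      = ⊤
NonFAfterEachU (U ∷ w) = Is-just (firstNonF w) × NonFAfterEachU w
NonFAfterEachU (D ∷ w) = NonFAfterEachU w
NonFAfterEachU (F ∷ w) = NonFAfterEachU w

NonFAfterEachU-++ : ∀ a b → NonFAfterEachU a → NonFAfterEachU b → NonFAfterEachU (a ++ b)
NonFAfterEachU-++ []      b _         rb = rb
NonFAfterEachU-++ (U ∷ a) b (j , ra)  rb =
  subst Is-just (sym (trans (firstNonF-++ a b) (<∣>-Is-just _ j))) j , NonFAfterEachU-++ a b ra rb
NonFAfterEachU-++ (D ∷ a) b ra        rb = NonFAfterEachU-++ a b ra rb
NonFAfterEachU-++ (F ∷ a) b ra        rb = NonFAfterEachU-++ a b ra rb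

uWeight-++ : ∀ v b → Is-just (firstNonF v) → uWeight (v ++ b) ≡ uWeight v
uWeight-++ (U ∷ v) b _ = refl
uWeight-++ (D ∷ v) b _ = refl
uWeight-++ (F ∷ v) b j = cong weightAfterF (trans (firstNonF-++ v b) (<∣>-Is-just _ j))

weight-++ : ∀ a b → NonFAfterEachU a → weight (a ++ b) ≡ weight a + weight b
weight-++ []      b _        = refl
weight-++ (U ∷ a) b (j , ra) =
  trans (cong₂ _+_ (uWeight-++ a b j) (weight-++ a b ra)) (sym (+-assoc (uWeight a) _ _))
weight-++ (D ∷ a) b ra       = weight-++ a b ra
weight-++ (F ∷ a) b ra       = weight-++ a b ra

uWeight-U : ∀ v → firstNonF v ≡ just U → uWeight v ≡ 2
uWeight-U (U ∷ v) _ = refl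
uWeight-U (F ∷ v) e = cong weightAfterF e

uWeight-F⁺ : ∀ v x → firstNonF v ≡ nothing → v ≢ [] → uWeight (v ++ x) ≡ weightAfterF (firstNonF x)
uWeight-F⁺ []      x _ v≢[] = ⊥-elim (v≢[] refl)
uWeight-F⁺ (F ∷ v) x e _    = cong weightAfterF (trans (firstNonF-++ v x) (cong (_<∣> _) e))

infixr 5 _⊕_

_⊕_ : Dyck → Dyck → Dyck
ε      ⊕ Q = Q
fr α β ⊕ Q = fr α (β ⊕ Q)

semilength-snoc : ∀ α σ → semilength (α ⊕ fr σ ε) ≡ suc (semilength α + semilength σ)
semilength-snoc ε        σ = cong suc (+-identityʳ (semilength σ))
semilength-snoc (fr a b) σ rewrite semilength-snoc b σ =
  cong suc (trans (+-suc (semilength a) _) (cong suc (sym (+-assoc (semilength a) _ _))))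

h-⊕ : ∀ α β → h (α ⊕ β) ≡ h α ⊔ h β
h-⊕ ε        β = refl
h-⊕ (fr a b) β rewrite h-⊕ b β = sym (⊔-assoc (suc (h a)) (h b) (h β))

h-⊕-≥ˡ : ∀ α β → h α ≤ h (α ⊕ β)
h-⊕-≥ˡ α β = subst (h α ≤_) (sym (h-⊕ α β)) (m≤m⊔n (h α) (h β))

h-⊕-≥ʳ : ∀ α β → h β ≤ h (α ⊕ β)
h-⊕-≥ʳ α β = subst (h β ≤_) (sym (h-⊕ α β)) (m≤n⊔m (h α) (h β))

lastDec-snoc : ∀ α σ → lastDec (α ⊕ fr σ ε) ≡ just (α , σ)
lastDec-snoc ε        σ = refl
lastDec-snoc (fr a b) σ rewrite lastDec-snoc b σ = refl

data LastReturn : Dyck → Set where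
  empty : LastReturn ε
  _▷_   : ∀ α σ → LastReturn (α ⊕ fr σ ε)

lastReturn : ∀ P → LastReturn P
lastReturn ε        = empty
lastReturn (fr a b) with lastReturn b
... | empty = ε ▷ a
... | α ▷ σ = fr a α ▷ σ

InDh≥-⊕⁻ : ∀ α {β} → InDh≥ (α ⊕ β) → InDh≥ α × InDh≥ β
InDh≥-⊕⁻ ε        P∈                = ε-in , P∈
InDh≥-⊕⁻ (fr a b) (fr-in a∈ b⊕β∈ c) with InDh≥-⊕⁻ b b⊕β∈
... | b∈ , β∈ = fr-in a∈ b∈ (≤-trans (h-⊕-≥ˡ b _) c) , β∈

startsUU : Dyck → ℕ
startsUU (fr (fr _ _) _) = 1
startsUU _               = 0

countUUU : Dyck → ℕ
countUUU ε        = 0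
countUUU (fr α β) = startsUU α + countUUU α + countUUU β

countUUU-⊕ : ∀ α β → countUUU (α ⊕ β) ≡ countUUU α + countUUU β
countUUU-⊕ ε        β = refl
countUUU-⊕ (fr a b) β rewrite countUUU-⊕ b β = sym (+-assoc (startsUU a + countUUU a) _ _)

startsUU-fr : ∀ α γ → startsUU (fr α γ) ≡ 1 ⊓ h α
startsUU-fr ε        γ = refl
startsUU-fr (fr a b) γ = sym (m≤n⇒m⊓n≡m (≤-trans (s≤s z≤n) (m≤m⊔n (suc (h a)) (h b))))

startsUU-height : ∀ {β} γ → InDh≥ β → startsUU (fr β γ) + startsUU β ≡ 2 ⊓ h β
startsUU-height γ ε-in                           = refl
startsUU-height γ (fr-in {α = a} {β = c} _ _ c≤) rewrite m≥n⇒m⊔n≡m c≤ = cong suc (startsUU-fr a c)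

isPrefix-Uⁿ-++-D∷ : ∀ n a b → isPrefix (replicate n U) (a ++ D ∷ b) ≡ isPrefix (replicate n U) a
isPrefix-Uⁿ-++-D∷ zero    a       b = refl
isPrefix-Uⁿ-++-D∷ (suc n) []      b = refl
isPrefix-Uⁿ-++-D∷ (suc n) (x ∷ a) b = cong ((U =ˢ x) ∧_) (isPrefix-Uⁿ-++-D∷ n a b)

count-U⁺-++-D∷ : ∀ n a b → let X = replicate (suc n) U in
  count X (a ++ D ∷ b) ≡ count X a + count X b
count-U⁺-++-D∷ n []      b = refl
count-U⁺-++-D∷ n (x ∷ a) b =
  trans (cong₂ _+_ (cong ⟦_⟧ (isPrefix-Uⁿ-++-D∷ (suc n) (x ∷ a) b)) (count-U⁺-++-D∷ n a b))
        (sym (+-assoc ⟦ isPrefix (replicate (suc n) U) (x ∷ a) ⟧ _ _))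

startsUU-word : ∀ α → ⟦ isPrefix (U ∷ U ∷ []) (word α) ⟧ ≡ startsUU α
startsUU-word ε               = refl
startsUU-word (fr ε _)        = refl
startsUU-word (fr (fr _ _) _) = refl

count-UUU-word : ∀ P → count (U ∷ U ∷ U ∷ []) (word P) ≡ countUUU P
count-UUU-word ε        = refl
count-UUU-word (fr α β) = begin
  ⟦ isPrefix (U ∷ U ∷ []) (word α ++ D ∷ word β) ⟧ + count UUU (word α ++ D ∷ word β)
    ≡⟨ cong₂ _+_ (trans (cong ⟦_⟧ (isPrefix-Uⁿ-++-D∷ 2 (word α) (word β))) (startsUU-word α))
                 (count-U⁺-++-D∷ 2 (word α) (word β)) ⟩
  startsUU α + (count UUU (word α) + count UUU (word β))
    ≡⟨ cong (startsUU α +_) (cong₂ _+_ (count-UUU-word α) (count-UUU-word β)) ⟩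
  startsUU α + (countUUU α + countUUU β)
    ≡⟨ +-assoc (startsUU α) _ _ ⟨
  countUUU (fr α β) ∎
  where
  UUU : Word
  UUU = U ∷ U ∷ U ∷ []

-- The graph of φ, given by its defining equations on last-return decompositions
-- α ⊕ fr σ ε = α U σ D; in UUDD, σ = fr β γ = U β D γ.
data Graphφ : Dyck → Word → Set where
  ε    : Graphφ ε []
  UD   : ∀ {α wα} → Graphφ α wα → Graphφ (α ⊕ fr ε ε) (wα ++ F ∷ [])
  UUDD : ∀ {α β γ wα wβ wγ} → Graphφ α wα → Graphφ β wβ → Graphφ γ wγ →
         Graphφ (α ⊕ fr (fr β γ) ε) (wα ++ wγ ++ U ∷ wβ ++ D ∷ [])

snoc-bounds : ∀ α σ {k} → semilength (α ⊕ fr σ ε) ≤ suc k → semilength α ≤ k × semilength σ ≤ k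
snoc-bounds α σ le with ≤-pred (subst (_≤ _) (semilength-snoc α σ) le)
... | α+σ≤k = m+n≤o⇒m≤o (semilength α) α+σ≤k , m+n≤o⇒n≤o (semilength α) α+σ≤k

fr-bounds : ∀ β γ {k} → semilength (fr β γ) ≤ k → semilength β ≤ k × semilength γ ≤ k
fr-bounds β γ le with ≤-trans (n≤1+n _) le
... | β+γ≤k = m+n≤o⇒m≤o (semilength β) β+γ≤k , m+n≤o⇒n≤o (semilength β) β+γ≤k

graph-φ-fuel : ∀ k P → semilength P ≤ k → Graphφ P (φ-fuel k P)
graph-φ-fuel k P le with lastReturn P
graph-φ-fuel zero    .ε _ | empty = ε
graph-φ-fuel (suc k) .ε _ | empty = ε
graph-φ-fuel zero .(α ⊕ fr σ ε) le | α ▷ σ with () ← subst (_≤ 0) (semilength-snoc α σ) le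
graph-φ-fuel (suc k) .(α ⊕ fr ε ε) le | α ▷ ε rewrite lastDec-snoc α ε =
  UD (graph-φ-fuel k α (proj₁ (snoc-bounds α ε le)))
graph-φ-fuel (suc k) .(α ⊕ fr (fr β γ) ε) le | α ▷ fr β γ rewrite lastDec-snoc α (fr β γ)
  with snoc-bounds α (fr β γ) le
... | α≤k , σ≤k with fr-bounds β γ σ≤k
... | β≤k , γ≤k = UUDD (graph-φ-fuel k α α≤k) (graph-φ-fuel k β β≤k) (graph-φ-fuel k γ γ≤k)

graph-φ : ∀ P → Graphφ P (φ P)
graph-φ P = graph-φ-fuel (semilength P) P ≤-refl

2≤h-UUβDγD : ∀ α β γ → 2 ≤ h (α ⊕ fr (fr β γ) ε)
2≤h-UUβDγD α β γ =
  ≤-trans (s≤s (≤-trans (s≤s z≤n) (m≤m⊔n (suc (h β)) (h γ)))) (h-⊕-≥ʳ α (fr (fr β γ) ε))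

φ-lead : ∀ {P w} → Graphφ P w →
  (h P ≤ 1 × firstNonF w ≡ nothing) ⊎ (2 ≤ h P × firstNonF w ≡ just U)
φ-lead ε = inj₁ (z≤n , refl)
φ-lead (UD {α} {wα} gα) with φ-lead gα
... | inj₁ (h≤1 , e) = inj₁ ( subst (_≤ 1) (sym (h-⊕ α (fr ε ε))) (⊔-lub h≤1 ≤-refl)
                             , trans (firstNonF-++ wα _) (cong (_<∣> nothing) e) )
... | inj₂ (2≤h , e) = inj₂ ( ≤-trans 2≤h (h-⊕-≥ˡ α (fr ε ε))
                             , trans (firstNonF-++ wα _) (cong (_<∣> nothing) e) )
φ-lead (UUDD {α} {β} {γ} {wα} {wβ} {wγ} gα _ gγ) =
  inj₂ ( 2≤h-UUβDγD α β γ
       , firstNonF-++-U wα _ (lead gα) (firstNonF-++-U wγ _ (lead gγ) refl) )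
  where
  lead : ∀ {P w} → Graphφ P w → firstNonF w ≡ nothing ⊎ firstNonF w ≡ just U
  lead g = Sum.map proj₂ proj₂ (φ-lead g)

φ-NonFAfterEachU : ∀ {P w} → Graphφ P w → NonFAfterEachU w
φ-NonFAfterEachU ε = tt
φ-NonFAfterEachU (UD {wα = wα} gα) = NonFAfterEachU-++ wα _ (φ-NonFAfterEachU gα) tt
φ-NonFAfterEachU (UUDD {wα = wα} {wβ} {wγ} gα gβ gγ) =
  NonFAfterEachU-++ wα _ (φ-NonFAfterEachU gα)
    (NonFAfterEachU-++ wγ _ (φ-NonFAfterEachU gγ)
      (firstNonF-++-D∷ wβ [] , NonFAfterEachU-++ wβ _ (φ-NonFAfterEachU gβ) tt))

uWeight-φ-low : ∀ {β w} → Graphφ β w → h β ≤ 1 → firstNonF w ≡ nothing →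
                uWeight (w ++ D ∷ []) ≡ 2 ⊓ h β
uWeight-φ-low ε _ _ = refl
uWeight-φ-low (UD {α} {wα} _) h≤1 e = begin
  uWeight ((wα ++ F ∷ []) ++ D ∷ [])
    ≡⟨ uWeight-F⁺ (wα ++ F ∷ []) (D ∷ []) e (λ eq → contradiction (++-conicalʳ wα (F ∷ []) eq) λ ()) ⟩
  1
    ≡⟨ cong (2 ⊓_) (≤-antisym h≤1 (h-⊕-≥ʳ α (fr ε ε))) ⟨
  2 ⊓ h (α ⊕ fr ε ε) ∎
uWeight-φ-low (UUDD {α} {β} {γ} _ _ _) h≤1 _ =
  ⊥-elim (<-irrefl refl (≤-trans (2≤h-UUβDγD α β γ) h≤1))

uWeight-φ : ∀ {β w} → Graphφ β w → uWeight (w ++ D ∷ []) ≡ 2 ⊓ h β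
uWeight-φ {w = w} g with φ-lead g
... | inj₁ (h≤1 , e) = uWeight-φ-low g h≤1 e
... | inj₂ (2≤h , e) = begin
  uWeight (w ++ D ∷ []) ≡⟨ uWeight-++ w _ (subst Is-just (sym e) (just tt)) ⟩
  uWeight w             ≡⟨ uWeight-U w e ⟩
  2                     ≡⟨ m≤n⇒m⊓n≡m 2≤h ⟨
  2 ⊓ _                 ∎

weight-φ : ∀ {P w} → Graphφ P w → InDh≥ P → weight w ≡ countUUU P
weight-φ ε _ = refl
weight-φ (UD {α} {wα} gα) P∈ = begin
  weight (wα ++ F ∷ []) ≡⟨ weight-++ wα _ (φ-NonFAfterEachU gα) ⟩
  weight wα + 0         ≡⟨ cong (_+ 0) (weight-φ gα (proj₁ (InDh≥-⊕⁻ α P∈))) ⟩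
  countUUU α + 0        ≡⟨ countUUU-⊕ α (fr ε ε) ⟨
  countUUU (α ⊕ fr ε ε) ∎
weight-φ (UUDD {α} {β} {γ} {wα} {wβ} {wγ} gα gβ gγ) P∈
  with InDh≥-⊕⁻ α P∈
... | α∈ , fr-in (fr-in β∈ γ∈ _) _ _ = begin
  weight (wα ++ wγ ++ U ∷ wβ ++ D ∷ [])
    ≡⟨ weight-++ wα _ (φ-NonFAfterEachU gα) ⟩
  weight wα + weight (wγ ++ U ∷ wβ ++ D ∷ [])
    ≡⟨ cong (weight wα +_) (weight-++ wγ _ (φ-NonFAfterEachU gγ)) ⟩
  weight wα + (weight wγ + (uWeight (wβ ++ D ∷ []) + weight (wβ ++ D ∷ [])))
    ≡⟨ cong₂ _+_ (weight-φ gα α∈)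
         (cong₂ _+_ (weight-φ gγ γ∈)
           (cong₂ _+_ (trans (uWeight-φ gβ) (sym (startsUU-height γ β∈)))
                      (trans (weight-++ wβ _ (φ-NonFAfterEachU gβ)) (cong (_+ 0) (weight-φ gβ β∈))))) ⟩
  cα + (cγ + ((startsUU (fr β γ) + startsUU β) + (cβ + 0)))
    ≡⟨ cong (cα +_) (rearrange cγ (startsUU (fr β γ)) (startsUU β) cβ) ⟩
  cα + countUUU (fr (fr β γ) ε)
    ≡⟨ countUUU-⊕ α (fr (fr β γ) ε) ⟨
  countUUU (α ⊕ fr (fr β γ) ε) ∎
  where
  cα cβ cγ : ℕ
  cα = countUUU α
  cβ = countUUU β
  cγ = countUUU γ
  rearrange : ∀ c s t b → c + ((s + t) + (b + 0)) ≡ s + (t + b + c) + 0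
  rearrange = solve-∀

theorem4 : (n : ℕ) (P : Dyck) → semilength P ≡ n → InDh≥ P →
    count (U ∷ U ∷ U ∷ []) (word P)
      ≡ countPlus (U ∷ []) F (D ∷ []) (φ P)
        + 2 * (countPlus (U ∷ []) F (U ∷ []) (φ P) + count (U ∷ U ∷ []) (φ P))
theorem4 _ P _ P∈ = begin
  count (U ∷ U ∷ U ∷ []) (word P) ≡⟨ count-UUU-word P ⟩
  countUUU P                      ≡⟨ weight-φ (graph-φ P) P∈ ⟨
  weight (φ P)                    ≡⟨ weight-decomposition (φ P) ⟩
  countPlus (U ∷ []) F (D ∷ []) (φ P)
    + 2 * (countPlus (U ∷ []) F (U ∷ []) (φ P) + count (U ∷ U ∷ []) (φ P)) ∎
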